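{- Let $t,u:\Gamma\vdash A$ be two terms of IKC. If for every Cartesian closed category $\mathcal{C}$ equipped with an adjunction $L\dashv R$ (and every choice of object interpreting $\iota$) it is the case that $\llbracket t\rrbracket=\llbracket u\rrbracket:\llbracket\Gamma\rrbracket\to\llbracket A\rrbracket$ in $\mathcal{C}$, then $\Gamma\vdash t\approx u:A$.
   Context: Syntax of IKC. Types $A,B ::= \iota\mid A\Rightarrow B\mid\Box A$. Contexts $\Gamma ::= \cdot\mid\Gamma,A\mid\Gamma,\blacksquare$ (snoc lists; $\blacksquare$ a lock). Variables: $\mathsf{zero}:(\Gamma,A)\vdash_{var}A$; $\mathsf{succ}\,v:(\Gamma,B)\vdash_{var}A$ for $v:\Gamma\vdash_{var}A$. OPEs: $\mathsf{base}:\cdot\le\cdot$; $\mathsf{drop}\,o:\Gamma\le(\Gamma',A)$, $\mathsf{keep}\,o:(\Gamma,A)\le(\Gamma',A)$, $\mathsf{keep}_\blacksquare\,o:(\Gamma,\blacksquare)\le(\Gamma',\blacksquare)$; identity $\mathsf{id}$. Accessibility: $\mathsf{nil}:\Gamma\lhd(\Gamma,\blacksquare)$; $\mathsf{ext}\,e:\Delta\lhd(\Gamma,A)$ for $e:\Delta\lhd\Gamma$. Terms: $\mathsf{var}\,v$; $\lambda t$; $\mathsf{app}(t,u)$; $\Gamma\vdash\mathsf{box}\,t:\Box A$ for $(\Gamma,\blacksquare)\vdash t:A$; $\Gamma\vdash\mathsf{unbox}(t,e):A$ for $\Delta\vdash t:\Box A$, $e:\Delta\lhd\Gamma$. Weakening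 $\mathsf{wk}(o,t)$ by structural recursion (factoring $o$ through $e$ at $\mathsf{unbox}$). Substitutions: $\mathsf{empty}$, $(s,t)$, $\mathsf{lock}(s,e):\Gamma\vdash_{sub}(\Delta,\blacksquare)$ for $s:\Theta\vdash_{sub}\Delta$, $e:\Theta\lhd\Gamma$; $t[s]$ standard action, $\mathsf{id}_s$ identity. $\mathsf{factor}\,\mathsf{nil}=\mathsf{keep}_\blacksquare\mathsf{id}$, $\mathsf{factor}(\mathsf{ext}\,e)=\mathsf{drop}(\mathsf{factor}\,e)$. Equivalence $\approx$: least congruence containing $\mathsf{app}(\lambda t,u)\approx t[(\mathsf{id}_s,u)]$; $t\approx\lambda\,\mathsf{app}(\mathsf{wk}(\mathsf{drop}\,\mathsf{id},t),\mathsf{var}\,\mathsf{zero})$; $\mathsf{unbox}(\mathsf{box}\,t,e)\approx\mathsf{wk}(\mathsf{factor}\,e,t)$; $t\approx\mathsf{box}(\mathsf{unbox}(t,\mathsf{nil}))$. Categorical interpretation in a CCC $\mathcal{C}$ with adjunction $L\dashv R$ (unit $\eta$, counit $\varepsilon$): $\llbracket\iota\rrbracket$ a chosen object, $\llbracket A\Rightarrow B\rrbracket$ the exponential, $\llbracket\Box A\rrbracket=R\llbracket A\rrbracket$; $\llbracket\cdot\rrbracket$ terminal, $\llbracket\Gamma,A\rrbracket=\llbracket\Gamma\rrbracket\times\llbracket A\rrbracket$, $\llbracket\Gamma,\blacksquare\rrbracket=L\llbracket\Gamma\rrbracket$. For $e:\Delta\lhd\Gamma$, $\llbracket e\rrbracket:\llbracket\Gamma\rrbracket\to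 L\llbracket\Delta\rrbracket$ with $\llbracket\mathsf{nil}\rrbracket=\mathrm{id}$, $\llbracket\mathsf{ext}\,e\rrbracket=\llbracket e\rrbracket\circ\pi_1$. Terms: variables as projections, $\lambda$ by currying, $\mathsf{app}$ via evaluation, $\llbracket\mathsf{box}\,t\rrbracket=R\llbracket t\rrbracket\circ\eta_{\llbracket\Gamma\rrbracket}$, $\llbracket\mathsf{unbox}(t,e)\rrbracket=\varepsilon_{\llbracket A\rrbracket}\circ L\llbracket t\rrbracket\circ\llbracket e\rrbracket$. -}

module Defs where

open import Level using (Level; _⊔_; suc)
open import Relation.Binary using (Rel; IsEquivalence)

infixr 7 _⇒_
infixl 5 _,_ _,■

data Ty : Set where
  ι   : Ty
  _⇒_ : Ty → Ty → Ty
  □_  : Ty → Ty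

data Ctx : Set where
  ·    : Ctx
  _,_  : Ctx → Ty → Ctx
  _,■  : Ctx → Ctx

-- variables  Γ ⊢var A  (cannot cross a lock)
data _⊢var_ : Ctx → Ty → Set where
  zero : ∀ {Γ A} → (Γ , A) ⊢var A
  succ : ∀ {Γ A B} → Γ ⊢var A → (Γ , B) ⊢var A

data _≤_ : Ctx → Ctx → Set where
  base  : · ≤ ·
  drop  : ∀ {Γ Γ' A} → Γ ≤ Γ' → Γ ≤ (Γ' , A)
  keep  : ∀ {Γ Γ' A} → Γ ≤ Γ' → (Γ , A) ≤ (Γ' , A)
  keep■ : ∀ {Γ Γ'} → Γ ≤ Γ' → (Γ ,■) ≤ (Γ' ,■)

idOPE : ∀ {Γ} → Γ ≤ Γ
idOPE {·}     = base
idOPE {Γ , A} = keep idOPE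
idOPE {Γ ,■}  = keep■ idOPE

data _◁_ : Ctx → Ctx → Set where
  nil : ∀ {Γ} → Γ ◁ (Γ ,■)
  ext : ∀ {Δ Γ A} → Δ ◁ Γ → Δ ◁ (Γ , A)

data _⊢_ : Ctx → Ty → Set where
  var   : ∀ {Γ A} → Γ ⊢var A → Γ ⊢ A
  lam   : ∀ {Γ A B} → (Γ , A) ⊢ B → Γ ⊢ (A ⇒ B)
  app   : ∀ {Γ A B} → Γ ⊢ (A ⇒ B) → Γ ⊢ A → Γ ⊢ B
  box   : ∀ {Γ A} → (Γ ,■) ⊢ A → Γ ⊢ (□ A)
  unbox : ∀ {Γ Δ A} → Δ ⊢ (□ A) → Δ ◁ Γ → Γ ⊢ A

factor : ∀ {Δ Γ} → Δ ◁ Γ → (Δ ,■) ≤ Γ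
factor nil     = keep■ idOPE
factor (ext e) = drop (factor e)

record FactorWk (Δ Γ' : Ctx) : Set where
  constructor fw
  field
    {ctx} : Ctx
    ope   : Δ ≤ ctx
    acc   : ctx ◁ Γ'

factorWk : ∀ {Δ Γ Γ'} → Δ ◁ Γ → Γ ≤ Γ' → FactorWk Δ Γ'
factorWk nil     (drop o)  with factorWk nil o
... | fw o' e' = fw o' (ext e')
factorWk nil     (keep■ o) = fw o nil
factorWk (ext e) (drop o)  with factorWk (ext e) o
... | fw o' e' = fw o' (ext e')
factorWk (ext e) (keep o)  with factorWk e o
... | fw o' e' = fw o' (ext e')

wkVar : ∀ {Γ Γ' A} → Γ ≤ Γ' → Γ ⊢var A → Γ' ⊢var A
wkVar (drop o) v        = succ (wkVar o v)
wkVar (keep o) zero     = zero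
wkVar (keep o) (succ v) = succ (wkVar o v)

wk : ∀ {Γ Γ' A} → Γ ≤ Γ' → Γ ⊢ A → Γ' ⊢ A
wk o (var v)     = var (wkVar o v)
wk o (lam t)     = lam (wk (keep o) t)
wk o (app t u)   = app (wk o t) (wk o u)
wk o (box t)     = box (wk (keep■ o) t)
wk o (unbox t e) = unbox (wk (FactorWk.ope (factorWk e o)) t) (FactorWk.acc (factorWk e o))

data _⊢sub_ : Ctx → Ctx → Set where
  empty : ∀ {Γ} → Γ ⊢sub ·
  _,ₛ_  : ∀ {Γ Δ A} → Γ ⊢sub Δ → Γ ⊢ A → Γ ⊢sub (Δ , A)
  lock  : ∀ {Γ Δ Θ} → Θ ⊢sub Δ → Θ ◁ Γ → Γ ⊢sub (Δ ,■)

wkSub : ∀ {Γ Γ' Δ} → Γ ≤ Γ' → Γ ⊢sub Δ → Γ' ⊢sub Δ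
wkSub o empty      = empty
wkSub o (s ,ₛ t)   = wkSub o s ,ₛ wk o t
wkSub o (lock s e) = lock (wkSub (FactorWk.ope (factorWk e o)) s) (FactorWk.acc (factorWk e o))

idₛ : ∀ {Γ} → Γ ⊢sub Γ
idₛ {·}     = empty
idₛ {Γ , A} = wkSub (drop idOPE) idₛ ,ₛ var zero
idₛ {Γ ,■}  = lock idₛ nil

substVar : ∀ {Γ Δ A} → Δ ⊢var A → Γ ⊢sub Δ → Γ ⊢ A
substVar zero     (s ,ₛ t) = t
substVar (succ v) (s ,ₛ t) = substVar v s

record FactorSub (Δ' Γ : Ctx) : Set where
  constructor fs
  field
    {ctx} : Ctx
    sub   : ctx ⊢sub Δ'
    acc   : ctx ◁ Γ

factorSub : ∀ {Δ' Δ Γ} → Δ' ◁ Δ → Γ ⊢sub Δ → FactorSub Δ' Γ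
factorSub nil     (lock s e) = fs s e
factorSub (ext e) (s ,ₛ t)   = factorSub e s

_[_] : ∀ {Γ Δ A} → Δ ⊢ A → Γ ⊢sub Δ → Γ ⊢ A
var v [ s ]     = substVar v s
lam t [ s ]     = lam (t [ wkSub (drop idOPE) s ,ₛ var zero ])
app t u [ s ]   = app (t [ s ]) (u [ s ])
box t [ s ]     = box (t [ lock s nil ])
unbox t e [ s ] = unbox (t [ FactorSub.sub (factorSub e s) ]) (FactorSub.acc (factorSub e s))

infix 4 _≈_
data _≈_ : ∀ {Γ A} → Γ ⊢ A → Γ ⊢ A → Set where
  ≈-refl  : ∀ {Γ A} {t : Γ ⊢ A} → t ≈ t
  ≈-sym   : ∀ {Γ A} {t u : Γ ⊢ A} → t ≈ u → u ≈ t
  ≈-trans : ∀ {Γ A} {t u v : Γ ⊢ A} → t ≈ u → u ≈ v → t ≈ v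
  cong-lam   : ∀ {Γ A B} {t t' : (Γ , A) ⊢ B} → t ≈ t' → lam t ≈ lam t'
  cong-app   : ∀ {Γ A B} {t t' : Γ ⊢ (A ⇒ B)} {u u' : Γ ⊢ A} →
               t ≈ t' → u ≈ u' → app t u ≈ app t' u'
  cong-box   : ∀ {Γ A} {t t' : (Γ ,■) ⊢ A} → t ≈ t' → box t ≈ box t'
  cong-unbox : ∀ {Γ Δ A} {t t' : Δ ⊢ (□ A)} {e : Δ ◁ Γ} →
               t ≈ t' → unbox t e ≈ unbox t' e
  ⇒-β : ∀ {Γ A B} (t : (Γ , A) ⊢ B) (u : Γ ⊢ A) → app (lam t) u ≈ t [ idₛ ,ₛ u ]
  ⇒-η : ∀ {Γ A B} (t : Γ ⊢ (A ⇒ B)) → t ≈ lam (app (wk (drop idOPE) t) (var zero))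
  □-β : ∀ {Γ Δ A} (t : (Δ ,■) ⊢ A) (e : Δ ◁ Γ) → unbox (box t) e ≈ wk (factor e) t
  □-η : ∀ {Γ A} (t : Γ ⊢ (□ A)) → t ≈ box (unbox t nil)

record Category (o ℓ e : Level) : Set (suc (o ⊔ ℓ ⊔ e)) where
  infix  4 _≈ₕ_
  infixr 9 _∘_
  field
    Obj    : Set o
    _⇒ₕ_   : Obj → Obj → Set ℓ
    _≈ₕ_   : ∀ {X Y} → Rel (X ⇒ₕ Y) e
    id     : ∀ {X} → X ⇒ₕ X
    _∘_    : ∀ {X Y Z} → Y ⇒ₕ Z → X ⇒ₕ Y → X ⇒ₕ Z
    equiv  : ∀ {X Y} → IsEquivalence (_≈ₕ_ {X} {Y})
    ∘-resp-≈ : ∀ {X Y Z} {f f' : Y ⇒ₕ Z} {g g' : X ⇒ₕ Y} →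
               f ≈ₕ f' → g ≈ₕ g' → f ∘ g ≈ₕ f' ∘ g'
    assoc  : ∀ {W X Y Z} {f : W ⇒ₕ X} {g : X ⇒ₕ Y} {h : Y ⇒ₕ Z} →
             (h ∘ g) ∘ f ≈ₕ h ∘ (g ∘ f)
    identityˡ : ∀ {X Y} {f : X ⇒ₕ Y} → id ∘ f ≈ₕ f
    identityʳ : ∀ {X Y} {f : X ⇒ₕ Y} → f ∘ id ≈ₕ f

record CCC (o ℓ e : Level) : Set (suc (o ⊔ ℓ ⊔ e)) where
  field
    category : Category o ℓ e
  open Category category public
  infixr 7 _×_
  infixr 6 _⇨_
  field
    ⊤        : Obj
    !        : ∀ {X} → X ⇒ₕ ⊤
    !-unique : ∀ {X} (f : X ⇒ₕ ⊤) → ! ≈ₕ f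
    _×_      : Obj → Obj → Obj
    π₁       : ∀ {X Y} → (X × Y) ⇒ₕ X
    π₂       : ∀ {X Y} → (X × Y) ⇒ₕ Y
    ⟨_,_⟩    : ∀ {Z X Y} → Z ⇒ₕ X → Z ⇒ₕ Y → Z ⇒ₕ (X × Y)
    project₁ : ∀ {Z X Y} {f : Z ⇒ₕ X} {g : Z ⇒ₕ Y} → π₁ ∘ ⟨ f , g ⟩ ≈ₕ f
    project₂ : ∀ {Z X Y} {f : Z ⇒ₕ X} {g : Z ⇒ₕ Y} → π₂ ∘ ⟨ f , g ⟩ ≈ₕ g
    ⟨⟩-unique : ∀ {Z X Y} {f : Z ⇒ₕ X} {g : Z ⇒ₕ Y} {h : Z ⇒ₕ (X × Y)} →
                π₁ ∘ h ≈ₕ f → π₂ ∘ h ≈ₕ g → ⟨ f , g ⟩ ≈ₕ h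
    _⇨_      : Obj → Obj → Obj
    eval     : ∀ {X Y} → ((X ⇨ Y) × X) ⇒ₕ Y
    curry    : ∀ {Z X Y} → (Z × X) ⇒ₕ Y → Z ⇒ₕ (X ⇨ Y)
    eval-β   : ∀ {Z X Y} {f : (Z × X) ⇒ₕ Y} →
               eval ∘ ⟨ curry f ∘ π₁ , id ∘ π₂ ⟩ ≈ₕ f
    curry-unique : ∀ {Z X Y} {f : (Z × X) ⇒ₕ Y} {g : Z ⇒ₕ (X ⇨ Y)} →
                   eval ∘ ⟨ g ∘ π₁ , id ∘ π₂ ⟩ ≈ₕ f → curry f ≈ₕ g

record Endofunctor {o ℓ e} (𝒞 : Category o ℓ e) : Set (o ⊔ ℓ ⊔ e) where
  open Category 𝒞
  field
    F₀ : Obj → Obj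
    F₁ : ∀ {X Y} → X ⇒ₕ Y → F₀ X ⇒ₕ F₀ Y
    identity     : ∀ {X} → F₁ (id {X}) ≈ₕ id
    homomorphism : ∀ {X Y Z} {f : X ⇒ₕ Y} {g : Y ⇒ₕ Z} → F₁ (g ∘ f) ≈ₕ F₁ g ∘ F₁ f
    F-resp-≈     : ∀ {X Y} {f g : X ⇒ₕ Y} → f ≈ₕ g → F₁ f ≈ₕ F₁ g

record Adjunction {o ℓ e} {𝒞 : Category o ℓ e} (L R : Endofunctor 𝒞) : Set (o ⊔ ℓ ⊔ e) where
  open Category 𝒞
  module L = Endofunctor L
  module R = Endofunctor R
  field
    η : ∀ X → X ⇒ₕ R.F₀ (L.F₀ X)
    ε : ∀ X → L.F₀ (R.F₀ X) ⇒ₕ X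
    η-natural : ∀ {X Y} (f : X ⇒ₕ Y) → η Y ∘ f ≈ₕ R.F₁ (L.F₁ f) ∘ η X
    ε-natural : ∀ {X Y} (f : X ⇒ₕ Y) → ε Y ∘ L.F₁ (R.F₁ f) ≈ₕ f ∘ ε X
    zig : ∀ {X} → ε (L.F₀ X) ∘ L.F₁ (η X) ≈ₕ id
    zag : ∀ {X} → R.F₁ (ε X) ∘ η (R.F₀ X) ≈ₕ id

module Interp {o ℓ e} (𝒞 : CCC o ℓ e)
              (L R : Endofunctor (CCC.category 𝒞))
              (adj : Adjunction L R)
              (ιobj : CCC.Obj 𝒞) where
  open CCC 𝒞
  open Adjunction adj

  ⟦_⟧ty : Ty → Obj
  ⟦ ι ⟧ty     = ιobj
  ⟦ A ⇒ B ⟧ty = ⟦ A ⟧ty ⇨ ⟦ B ⟧ty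
  ⟦ □ A ⟧ty   = R.F₀ ⟦ A ⟧ty

  ⟦_⟧ctx : Ctx → Obj
  ⟦ · ⟧ctx     = ⊤
  ⟦ Γ , A ⟧ctx = ⟦ Γ ⟧ctx × ⟦ A ⟧ty
  ⟦ Γ ,■ ⟧ctx  = L.F₀ ⟦ Γ ⟧ctx

  ⟦_⟧acc : ∀ {Δ Γ} → Δ ◁ Γ → ⟦ Γ ⟧ctx ⇒ₕ L.F₀ ⟦ Δ ⟧ctx
  ⟦ nil ⟧acc   = id
  ⟦ ext e ⟧acc = ⟦ e ⟧acc ∘ π₁

  ⟦_⟧var : ∀ {Γ A} → Γ ⊢var A → ⟦ Γ ⟧ctx ⇒ₕ ⟦ A ⟧ty
  ⟦ zero ⟧var   = π₂
  ⟦ succ v ⟧var = ⟦ v ⟧var ∘ π₁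

  ⟦_⟧tm : ∀ {Γ A} → Γ ⊢ A → ⟦ Γ ⟧ctx ⇒ₕ ⟦ A ⟧ty
  ⟦ var v ⟧tm = ⟦ v ⟧var
  ⟦ lam t ⟧tm = curry ⟦ t ⟧tm
  ⟦ app t u ⟧tm = eval ∘ ⟨ ⟦ t ⟧tm , ⟦ u ⟧tm ⟩
  ⟦ box {Γ} t ⟧tm = R.F₁ ⟦ t ⟧tm ∘ η ⟦ Γ ⟧ctx
  ⟦ unbox {A = A} t e ⟧tm = ε ⟦ A ⟧ty ∘ (L.F₁ ⟦ t ⟧tm ∘ ⟦ e ⟧acc)

-- Completeness by normalisation by evaluation. Presheaves on the category of order-preserving
-- embeddings form a cartesian closed category with an adjunction L ⊣ R, where
-- (L X)(Γ) = Σ (Δ ◁ Γ). X(Δ) and (R X)(Γ) = X(Γ ,■). Reading a semantic value of this model back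
-- as a term gives, for every t, a term nf t that depends only on the interpretation of t; a
-- Kripke logical relation between values and terms, preserved by interpretation, shows that
-- nf t ≈ t. Hence ⟦t⟧ = ⟦u⟧ in this model gives t ≈ nf t ≡ nf u ≈ u.
{-# OPTIONS --safe #-}
module Submission where

open import Level using (0ℓ) renaming (suc to lsuc)
open import Data.Unit using (⊤; tt)
open import Data.Product using (_×_; proj₁; proj₂) renaming (_,_ to _&_)
open import Relation.Binary.Bundles using (Setoid)
import Relation.Binary.Reasoning.Setoid as SetoidReasoning
open import Relation.Binary.PropositionalEquality
  using (_≡_; refl; sym; trans; cong; cong₂; module ≡-Reasoning)
open import Defs
open FactorWk
open FactorSub

-- Order-preserving embeddings

infixr 9 _⊚_
_⊚_ : ∀ {Γ Γ' Γ''} → Γ ≤ Γ' → Γ' ≤ Γ'' → Γ ≤ Γ''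
o ⊚ drop o' = drop (o ⊚ o')
drop o ⊚ keep o' = drop (o ⊚ o')
keep o ⊚ keep o' = keep (o ⊚ o')
keep■ o ⊚ keep■ o' = keep■ (o ⊚ o')
base ⊚ base = base

⊚-identityˡ : ∀ {Γ Γ'} (o : Γ ≤ Γ') → idOPE ⊚ o ≡ o
⊚-identityˡ base = refl
⊚-identityˡ (drop o) = cong drop (⊚-identityˡ o)
⊚-identityˡ (keep o) = cong keep (⊚-identityˡ o)
⊚-identityˡ (keep■ o) = cong keep■ (⊚-identityˡ o)

⊚-identityʳ : ∀ {Γ Γ'} (o : Γ ≤ Γ') → o ⊚ idOPE ≡ o
⊚-identityʳ base = refl
⊚-identityʳ (drop o) = cong drop (⊚-identityʳ o)
⊚-identityʳ (keep o) = cong keep (⊚-identityʳ o)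
⊚-identityʳ (keep■ o) = cong keep■ (⊚-identityʳ o)

⊚-assoc : ∀ {Γ₁ Γ₂ Γ₃ Γ₄} (o₁ : Γ₁ ≤ Γ₂) (o₂ : Γ₂ ≤ Γ₃) (o₃ : Γ₃ ≤ Γ₄) →
          (o₁ ⊚ o₂) ⊚ o₃ ≡ o₁ ⊚ (o₂ ⊚ o₃)
⊚-assoc o₁ o₂ (drop o₃) = cong drop (⊚-assoc o₁ o₂ o₃)
⊚-assoc o₁ (drop o₂) (keep o₃) = cong drop (⊚-assoc o₁ o₂ o₃)
⊚-assoc (drop o₁) (keep o₂) (keep o₃) = cong drop (⊚-assoc o₁ o₂ o₃)
⊚-assoc (keep o₁) (keep o₂) (keep o₃) = cong keep (⊚-assoc o₁ o₂ o₃)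
⊚-assoc (keep■ o₁) (keep■ o₂) (keep■ o₃) = cong keep■ (⊚-assoc o₁ o₂ o₃)
⊚-assoc base base base = refl

⊚-drop-id : ∀ {Γ Γ' A} (o : Γ ≤ Γ') → o ⊚ drop {A = A} idOPE ≡ drop o
⊚-drop-id o = cong drop (⊚-identityʳ o)

drop-id-⊚-keep : ∀ {Γ Γ' A} (o : Γ ≤ Γ') → drop {A = A} idOPE ⊚ keep o ≡ drop o
drop-id-⊚-keep o = cong drop (⊚-identityˡ o)

drop-id-natural : ∀ {Γ Γ' A} (o : Γ ≤ Γ') → o ⊚ drop {A = A} idOPE ≡ drop idOPE ⊚ keep o
drop-id-natural o = trans (⊚-drop-id o) (sym (drop-id-⊚-keep o))

wkVar-id : ∀ {Γ A} (v : Γ ⊢var A) → wkVar idOPE v ≡ v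
wkVar-id zero = refl
wkVar-id (succ v) = cong succ (wkVar-id v)

wkVar-⊚ : ∀ {Γ Γ' Γ'' A} (o : Γ ≤ Γ') (o' : Γ' ≤ Γ'') (v : Γ ⊢var A) →
          wkVar o' (wkVar o v) ≡ wkVar (o ⊚ o') v
wkVar-⊚ o (drop o') v = cong succ (wkVar-⊚ o o' v)
wkVar-⊚ (drop o) (keep o') v = cong succ (wkVar-⊚ o o' v)
wkVar-⊚ (keep o) (keep o') zero = refl
wkVar-⊚ (keep o) (keep o') (succ v) = cong succ (wkVar-⊚ o o' v)
wkVar-⊚ base base ()
wkVar-⊚ (keep■ o) (keep■ o') ()

factorWk-id : ∀ {Δ Γ} (e : Δ ◁ Γ) → factorWk e idOPE ≡ fw idOPE e
factorWk-id nil = refl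
factorWk-id (ext e) rewrite factorWk-id e = refl

factorWk-drop : ∀ {Δ Γ Γ' A} (e : Δ ◁ Γ) (o : Γ ≤ Γ') →
                factorWk e (drop {A = A} o) ≡ fw (ope (factorWk e o)) (ext (acc (factorWk e o)))
factorWk-drop nil o = refl
factorWk-drop (ext e) o = refl

infixl 9 _⊚ᶠ_
_⊚ᶠ_ : ∀ {Δ Γ' Γ''} → FactorWk Δ Γ' → Γ' ≤ Γ'' → FactorWk Δ Γ''
fw o e ⊚ᶠ o' = fw (o ⊚ ope (factorWk e o')) (acc (factorWk e o'))

factorWk-⊚ : ∀ {Δ Γ Γ' Γ''} (e : Δ ◁ Γ) (o : Γ ≤ Γ') (o' : Γ' ≤ Γ'') →
             factorWk e (o ⊚ o') ≡ factorWk e o ⊚ᶠ o'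
factorWk-⊚ e o (drop {A = A} o')
  rewrite factorWk-drop {A = A} e (o ⊚ o') | factorWk-drop {A = A} (acc (factorWk e o)) o'
        | factorWk-⊚ e o o' = refl
factorWk-⊚ e (drop o) (keep {A = A} o')
  rewrite factorWk-drop {A = A} e (o ⊚ o') | factorWk-drop {A = A} e o | factorWk-⊚ e o o' = refl
factorWk-⊚ (ext e) (keep o) (keep o') rewrite factorWk-⊚ e o o' = refl
factorWk-⊚ nil (keep■ o) (keep■ o') = refl
factorWk-⊚ () base base

factorWk-factor : ∀ {Δ Γ} (e : Δ ◁ Γ) → factorWk nil (factor e) ≡ fw idOPE e
factorWk-factor nil = refl
factorWk-factor (ext e) rewrite factorWk-factor e = refl

factor-natural : ∀ {Δ Γ Γ'} (e : Δ ◁ Γ) (o : Γ ≤ Γ') →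
                 factor e ⊚ o ≡ keep■ (ope (factorWk e o)) ⊚ factor (acc (factorWk e o))
factor-natural e (drop {A = A} o) rewrite factorWk-drop {A = A} e o = cong drop (factor-natural e o)
factor-natural nil (keep■ o) = cong keep■ (trans (⊚-identityˡ o) (sym (⊚-identityʳ o)))
factor-natural (ext e) (keep o) = cong drop (factor-natural e o)

wk-id : ∀ {Γ A} (t : Γ ⊢ A) → wk idOPE t ≡ t
wk-id (var v) = cong var (wkVar-id v)
wk-id (lam t) = cong lam (wk-id t)
wk-id (app t u) = cong₂ app (wk-id t) (wk-id u)
wk-id (box t) = cong box (wk-id t)
wk-id (unbox t e) rewrite factorWk-id e = cong (λ t' → unbox t' e) (wk-id t)

wk-⊚ : ∀ {Γ Γ' Γ'' A} (o : Γ ≤ Γ') (o' : Γ' ≤ Γ'') (t : Γ ⊢ A) → wk o' (wk o t) ≡ wk (o ⊚ o') t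
wk-⊚ o o' (var v) = cong var (wkVar-⊚ o o' v)
wk-⊚ o o' (lam t) = cong lam (wk-⊚ (keep o) (keep o') t)
wk-⊚ o o' (app t u) = cong₂ app (wk-⊚ o o' t) (wk-⊚ o o' u)
wk-⊚ o o' (box t) = cong box (wk-⊚ (keep■ o) (keep■ o') t)
wk-⊚ o o' (unbox t e) rewrite factorWk-⊚ e o o' = cong (λ t' → unbox t' _) (wk-⊚ _ _ t)

wkSub-id : ∀ {Γ Δ} (s : Γ ⊢sub Δ) → wkSub idOPE s ≡ s
wkSub-id empty = refl
wkSub-id (s ,ₛ t) = cong₂ _,ₛ_ (wkSub-id s) (wk-id t)
wkSub-id (lock s e) rewrite factorWk-id e = cong (λ s' → lock s' e) (wkSub-id s)

wkSub-⊚ : ∀ {Γ Γ' Γ'' Δ} (o : Γ ≤ Γ') (o' : Γ' ≤ Γ'') (s : Γ ⊢sub Δ) →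
          wkSub o' (wkSub o s) ≡ wkSub (o ⊚ o') s
wkSub-⊚ o o' empty = refl
wkSub-⊚ o o' (s ,ₛ t) = cong₂ _,ₛ_ (wkSub-⊚ o o' s) (wk-⊚ o o' t)
wkSub-⊚ o o' (lock s e) rewrite factorWk-⊚ e o o' = cong (λ s' → lock s' _) (wkSub-⊚ _ _ s)

-- Substitution

infixl 25 _↾_
_↾_ : ∀ {Θ Γ Γ'} → Θ ⊢sub Γ' → Γ ≤ Γ' → Θ ⊢sub Γ
empty ↾ base = empty
(τ ,ₛ u) ↾ drop o = τ ↾ o
(τ ,ₛ u) ↾ keep o = (τ ↾ o) ,ₛ u
lock τ e ↾ keep■ o = lock (τ ↾ o) e

↾-id : ∀ {Θ Γ} (τ : Θ ⊢sub Γ) → τ ↾ idOPE ≡ τ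
↾-id empty = refl
↾-id (τ ,ₛ u) = cong (_,ₛ u) (↾-id τ)
↾-id (lock τ e) = cong (λ τ' → lock τ' e) (↾-id τ)

wkSub-↾ : ∀ {Θ Θ' Γ Γ'} (o' : Θ ≤ Θ') (τ : Θ ⊢sub Γ') (o : Γ ≤ Γ') →
          wkSub o' τ ↾ o ≡ wkSub o' (τ ↾ o)
wkSub-↾ o' empty base = refl
wkSub-↾ o' (τ ,ₛ u) (drop o) = wkSub-↾ o' τ o
wkSub-↾ o' (τ ,ₛ u) (keep o) = cong (_,ₛ wk o' u) (wkSub-↾ o' τ o)
wkSub-↾ o' (lock τ e) (keep■ o) = cong (λ τ' → lock τ' _) (wkSub-↾ _ τ o)

substVar-wkVar : ∀ {Θ Γ Γ' A} (o : Γ ≤ Γ') (v : Γ ⊢var A) (τ : Θ ⊢sub Γ') →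
                 substVar (wkVar o v) τ ≡ substVar v (τ ↾ o)
substVar-wkVar (drop o) v (τ ,ₛ u) = substVar-wkVar o v τ
substVar-wkVar (keep o) zero (τ ,ₛ u) = refl
substVar-wkVar (keep o) (succ v) (τ ,ₛ u) = substVar-wkVar o v τ

factorSub-↾ : ∀ {Θ Δ Γ Γ'} (e : Δ ◁ Γ) (o : Γ ≤ Γ') (τ : Θ ⊢sub Γ') →
              let r = factorSub (acc (factorWk e o)) τ in
              factorSub e (τ ↾ o) ≡ fs (sub r ↾ ope (factorWk e o)) (acc r)
factorSub-↾ nil (drop o) (τ ,ₛ u) = factorSub-↾ nil o τ
factorSub-↾ nil (keep■ o) (lock τ e) = refl
factorSub-↾ (ext e) (drop o) (τ ,ₛ u) = factorSub-↾ (ext e) o τ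
factorSub-↾ (ext e) (keep o) (τ ,ₛ u) = factorSub-↾ e o τ

subst-wk : ∀ {Θ Γ Γ' A} (o : Γ ≤ Γ') (t : Γ ⊢ A) (τ : Θ ⊢sub Γ') → wk o t [ τ ] ≡ t [ τ ↾ o ]
subst-wk o (var v) τ = substVar-wkVar o v τ
subst-wk o (lam t) τ = cong lam (trans (subst-wk (keep o) t _)
  (cong (λ τ' → t [ τ' ,ₛ var zero ]) (wkSub-↾ (drop idOPE) τ o)))
subst-wk o (app t u) τ = cong₂ app (subst-wk o t τ) (subst-wk o u τ)
subst-wk o (box t) τ = cong box (subst-wk (keep■ o) t (lock τ nil))
subst-wk o (unbox t e) τ rewrite factorSub-↾ e o τ = cong (λ t' → unbox t' _) (subst-wk _ t _)

wk-substVar : ∀ {Γ Γ' Δ A} (o : Γ ≤ Γ') (v : Δ ⊢var A) (s : Γ ⊢sub Δ) →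
              wk o (substVar v s) ≡ substVar v (wkSub o s)
wk-substVar o zero (s ,ₛ t) = refl
wk-substVar o (succ v) (s ,ₛ t) = wk-substVar o v s

factorSub-wkSub : ∀ {Γ Γ' Δ Δ'} (e : Δ' ◁ Δ) (s : Γ ⊢sub Δ) (o : Γ ≤ Γ') →
                  let r = factorSub e s ; r' = factorWk (acc r) o in
                  factorSub e (wkSub o s) ≡ fs (wkSub (ope r') (sub r)) (acc r')
factorSub-wkSub nil (lock s e) o = refl
factorSub-wkSub (ext e) (s ,ₛ t) o = factorSub-wkSub e s o

wkSub-drop-natural : ∀ {Γ Γ' Δ A} (o : Γ ≤ Γ') (s : Γ ⊢sub Δ) →
                     wkSub (drop {A = A} idOPE) (wkSub o s) ≡ wkSub (keep o) (wkSub (drop idOPE) s)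
wkSub-drop-natural o s = begin
  wkSub (drop idOPE) (wkSub o s)  ≡⟨ wkSub-⊚ o (drop idOPE) s ⟩
  wkSub (o ⊚ drop idOPE) s        ≡⟨ cong (λ o' → wkSub o' s) (drop-id-natural o) ⟩
  wkSub (drop idOPE ⊚ keep o) s   ≡⟨ wkSub-⊚ (drop idOPE) (keep o) s ⟨
  wkSub (keep o) (wkSub (drop idOPE) s) ∎
  where open ≡-Reasoning

wk-subst : ∀ {Γ Γ' Δ A} (o : Γ ≤ Γ') (t : Δ ⊢ A) (s : Γ ⊢sub Δ) → wk o (t [ s ]) ≡ t [ wkSub o s ]
wk-subst o (var v) s = wk-substVar o v s
wk-subst o (lam t) s = cong lam (trans (wk-subst (keep o) t _)
  (cong (λ s' → t [ s' ,ₛ var zero ]) (sym (wkSub-drop-natural o s))))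
wk-subst o (app t u) s = cong₂ app (wk-subst o t s) (wk-subst o u s)
wk-subst o (box t) s = cong box (wk-subst (keep■ o) t (lock s nil))
wk-subst o (unbox t e) s rewrite factorSub-wkSub e s o = cong (λ t' → unbox t' _) (wk-subst _ t _)

infixl 25 _∘ₛ_
_∘ₛ_ : ∀ {Θ Γ Δ} → Γ ⊢sub Δ → Θ ⊢sub Γ → Θ ⊢sub Δ
empty ∘ₛ τ = empty
(s ,ₛ t) ∘ₛ τ = (s ∘ₛ τ) ,ₛ (t [ τ ])
lock s e ∘ₛ τ = lock (s ∘ₛ sub (factorSub e τ)) (acc (factorSub e τ))

factorSub-∘ₛ : ∀ {Θ Γ Δ Δ'} (e : Δ' ◁ Δ) (s : Γ ⊢sub Δ) (τ : Θ ⊢sub Γ) →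
               let r = factorSub e s ; r' = factorSub (acc r) τ in
               factorSub e (s ∘ₛ τ) ≡ fs (sub r ∘ₛ sub r') (acc r')
factorSub-∘ₛ nil (lock s e) τ = refl
factorSub-∘ₛ (ext e) (s ,ₛ t) τ = factorSub-∘ₛ e s τ

wkSub-∘ₛ : ∀ {Θ Θ' Γ Δ} (o : Θ ≤ Θ') (s : Γ ⊢sub Δ) (τ : Θ ⊢sub Γ) →
           wkSub o (s ∘ₛ τ) ≡ s ∘ₛ wkSub o τ
wkSub-∘ₛ o empty τ = refl
wkSub-∘ₛ o (s ,ₛ t) τ = cong₂ _,ₛ_ (wkSub-∘ₛ o s τ) (wk-subst o t τ)
wkSub-∘ₛ o (lock s e) τ rewrite factorSub-wkSub e τ o = cong (λ s' → lock s' _) (wkSub-∘ₛ _ s _)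

wkSub-∘ₛ-↾ : ∀ {Θ Γ Γ' Δ} (o : Γ ≤ Γ') (s : Γ ⊢sub Δ) (τ : Θ ⊢sub Γ') →
             wkSub o s ∘ₛ τ ≡ s ∘ₛ (τ ↾ o)
wkSub-∘ₛ-↾ o empty τ = refl
wkSub-∘ₛ-↾ o (s ,ₛ t) τ = cong₂ _,ₛ_ (wkSub-∘ₛ-↾ o s τ) (subst-wk o t τ)
wkSub-∘ₛ-↾ o (lock s e) τ rewrite factorSub-↾ e o τ = cong (λ s' → lock s' _) (wkSub-∘ₛ-↾ _ s _)

wkSub-drop-∘ₛ : ∀ {Θ Γ Δ A} (s : Γ ⊢sub Δ) (τ : Θ ⊢sub Γ) (u : Θ ⊢ A) →
                wkSub (drop idOPE) s ∘ₛ (τ ,ₛ u) ≡ s ∘ₛ τ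
wkSub-drop-∘ₛ s τ u = trans (wkSub-∘ₛ-↾ (drop idOPE) s (τ ,ₛ u)) (cong (s ∘ₛ_) (↾-id τ))

subst-∘ₛ : ∀ {Θ Γ Δ A} (t : Δ ⊢ A) (s : Γ ⊢sub Δ) (τ : Θ ⊢sub Γ) → t [ s ] [ τ ] ≡ t [ s ∘ₛ τ ]
subst-∘ₛ (var zero) (s ,ₛ t) τ = refl
subst-∘ₛ (var (succ v)) (s ,ₛ t) τ = subst-∘ₛ (var v) s τ
subst-∘ₛ (lam t) s τ = cong lam (trans (subst-∘ₛ t _ _)
  (cong (λ s' → t [ s' ,ₛ var zero ])
    (trans (wkSub-drop-∘ₛ s _ _) (sym (wkSub-∘ₛ (drop idOPE) s τ)))))
subst-∘ₛ (app t u) s τ = cong₂ app (subst-∘ₛ t s τ) (subst-∘ₛ u s τ)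
subst-∘ₛ (box t) s τ = cong box (subst-∘ₛ t (lock s nil) (lock τ nil))
subst-∘ₛ (unbox t e) s τ rewrite factorSub-∘ₛ e s τ = cong (λ t' → unbox t' _) (subst-∘ₛ t _ _)

substVar-id : ∀ {Γ A} (v : Γ ⊢var A) → substVar v idₛ ≡ var v
substVar-id zero = refl
substVar-id (succ v) = begin
  substVar v (wkSub (drop idOPE) idₛ)  ≡⟨ wk-substVar (drop idOPE) v idₛ ⟨
  wk (drop idOPE) (substVar v idₛ)     ≡⟨ cong (wk (drop idOPE)) (substVar-id v) ⟩
  var (succ (wkVar idOPE v))           ≡⟨ cong (λ v' → var (succ v')) (wkVar-id v) ⟩
  var (succ v)                         ∎
  where open ≡-Reasoning

factorSub-id : ∀ {Γ Δ} (e : Δ ◁ Γ) → factorSub e idₛ ≡ fs idₛ e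
factorSub-id nil = refl
factorSub-id (ext {A = A} e)
  rewrite factorSub-wkSub e idₛ (drop {A = A} idOPE) | factorSub-id e
        | factorWk-drop {A = A} e idOPE | factorWk-id e
  = cong (λ s → fs s (ext e)) (wkSub-id idₛ)

subst-id : ∀ {Γ A} (t : Γ ⊢ A) → t [ idₛ ] ≡ t
subst-id (var v) = substVar-id v
subst-id (lam t) = cong lam (subst-id t)
subst-id (app t u) = cong₂ app (subst-id t) (subst-id u)
subst-id (box t) = cong box (subst-id t)
subst-id (unbox t e) rewrite factorSub-id e = cong (λ t' → unbox t' e) (subst-id t)

∘ₛ-identityʳ : ∀ {Γ Δ} (s : Γ ⊢sub Δ) → s ∘ₛ idₛ ≡ s
∘ₛ-identityʳ empty = refl
∘ₛ-identityʳ (s ,ₛ t) = cong₂ _,ₛ_ (∘ₛ-identityʳ s) (subst-id t)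
∘ₛ-identityʳ (lock s e) rewrite factorSub-id e = cong (λ s' → lock s' e) (∘ₛ-identityʳ s)

idₛ-↾ : ∀ {Γ Γ'} (o : Γ ≤ Γ') → idₛ ↾ o ≡ wkSub o idₛ
idₛ-↾ base = refl
idₛ-↾ (drop o) = begin
  wkSub (drop idOPE) idₛ ↾ o        ≡⟨ wkSub-↾ (drop idOPE) idₛ o ⟩
  wkSub (drop idOPE) (idₛ ↾ o)      ≡⟨ cong (wkSub (drop idOPE)) (idₛ-↾ o) ⟩
  wkSub (drop idOPE) (wkSub o idₛ)  ≡⟨ wkSub-⊚ o (drop idOPE) idₛ ⟩
  wkSub (o ⊚ drop idOPE) idₛ        ≡⟨ cong (λ o' → wkSub o' idₛ) (⊚-drop-id o) ⟩
  wkSub (drop o) idₛ                ∎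
  where open ≡-Reasoning
idₛ-↾ (keep o) = cong (_,ₛ var zero) (begin
  wkSub (drop idOPE) idₛ ↾ o        ≡⟨ wkSub-↾ (drop idOPE) idₛ o ⟩
  wkSub (drop idOPE) (idₛ ↾ o)      ≡⟨ cong (wkSub (drop idOPE)) (idₛ-↾ o) ⟩
  wkSub (drop idOPE) (wkSub o idₛ)  ≡⟨ wkSub-drop-natural o idₛ ⟩
  wkSub (keep o) (wkSub (drop idOPE) idₛ) ∎)
  where open ≡-Reasoning
idₛ-↾ (keep■ o) = cong (λ s → lock s nil) (idₛ-↾ o)

-- Conversion

≡⇒≈ : ∀ {Γ A} {t t' : Γ ⊢ A} → t ≡ t' → t ≈ t'
≡⇒≈ refl = ≈-refl

≈-setoid : Ctx → Ty → Setoid 0ℓ 0ℓ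
≈-setoid Γ A = record
  { Carrier = Γ ⊢ A
  ; _≈_ = _≈_
  ; isEquivalence = record { refl = ≈-refl ; sym = ≈-sym ; trans = ≈-trans }
  }

β-subst-wk : ∀ {Γ Γ' A B} (o : Γ ≤ Γ') (t : (Γ , A) ⊢ B) (u : Γ ⊢ A) →
             wk (keep o) t [ idₛ ,ₛ wk o u ] ≡ wk o (t [ idₛ ,ₛ u ])
β-subst-wk o t u = begin
  wk (keep o) t [ idₛ ,ₛ wk o u ]  ≡⟨ subst-wk (keep o) t (idₛ ,ₛ wk o u) ⟩
  t [ idₛ ↾ o ,ₛ wk o u ]          ≡⟨ cong (λ s → t [ s ,ₛ wk o u ]) (idₛ-↾ o) ⟩
  t [ wkSub o idₛ ,ₛ wk o u ]      ≡⟨ wk-subst o t (idₛ ,ₛ u) ⟨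
  wk o (t [ idₛ ,ₛ u ])            ∎
  where open ≡-Reasoning

wk-resp-≈ : ∀ {Γ Γ' A} (o : Γ ≤ Γ') {t t' : Γ ⊢ A} → t ≈ t' → wk o t ≈ wk o t'
wk-resp-≈ o ≈-refl = ≈-refl
wk-resp-≈ o (≈-sym p) = ≈-sym (wk-resp-≈ o p)
wk-resp-≈ o (≈-trans p q) = ≈-trans (wk-resp-≈ o p) (wk-resp-≈ o q)
wk-resp-≈ o (cong-lam p) = cong-lam (wk-resp-≈ (keep o) p)
wk-resp-≈ o (cong-app p q) = cong-app (wk-resp-≈ o p) (wk-resp-≈ o q)
wk-resp-≈ o (cong-box p) = cong-box (wk-resp-≈ (keep■ o) p)
wk-resp-≈ o (cong-unbox p) = cong-unbox (wk-resp-≈ _ p)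
wk-resp-≈ o (⇒-β t u) = ≈-trans (⇒-β (wk (keep o) t) (wk o u)) (≡⇒≈ (β-subst-wk o t u))
wk-resp-≈ o (⇒-η t) = ≈-trans (⇒-η (wk o t)) (≡⇒≈ (cong (λ t' → lam (app t' (var zero))) (begin
  wk (drop idOPE) (wk o t)  ≡⟨ wk-⊚ o (drop idOPE) t ⟩
  wk (o ⊚ drop idOPE) t     ≡⟨ cong (λ o' → wk o' t) (drop-id-natural o) ⟩
  wk (drop idOPE ⊚ keep o) t ≡⟨ wk-⊚ (drop idOPE) (keep o) t ⟨
  wk (keep o) (wk (drop idOPE) t) ∎)))
  where open ≡-Reasoning
wk-resp-≈ o (□-β t e) = ≈-trans (□-β _ _) (≡⇒≈ (begin
  wk (factor (acc (factorWk e o))) (wk (keep■ (ope (factorWk e o))) t)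
    ≡⟨ wk-⊚ _ _ t ⟩
  wk (keep■ (ope (factorWk e o)) ⊚ factor (acc (factorWk e o))) t
    ≡⟨ cong (λ o' → wk o' t) (factor-natural e o) ⟨
  wk (factor e ⊚ o) t
    ≡⟨ wk-⊚ _ _ t ⟨
  wk o (wk (factor e) t) ∎))
  where open ≡-Reasoning
wk-resp-≈ o (□-η t) = □-η (wk o t)

app-lam-wk : ∀ {Γ Γ' Δ A B} (t : (Δ , A) ⊢ B) (s : Γ ⊢sub Δ) (o : Γ ≤ Γ') (u : Γ' ⊢ A) →
             app (wk o (lam t [ s ])) u ≈ t [ wkSub o s ,ₛ u ]
app-lam-wk {Γ} {Δ = Δ} {A} t s o u = ≈-trans (⇒-β _ u) (≡⇒≈ (begin
  wk (keep o) (t [ s⁺ ]) [ idₛ ,ₛ u ]     ≡⟨ subst-wk (keep o) (t [ s⁺ ]) (idₛ ,ₛ u) ⟩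
  t [ s⁺ ] [ idₛ ↾ o ,ₛ u ]               ≡⟨ cong (λ τ → t [ s⁺ ] [ τ ,ₛ u ]) (idₛ-↾ o) ⟩
  t [ s⁺ ] [ wkSub o idₛ ,ₛ u ]           ≡⟨ subst-∘ₛ t s⁺ (wkSub o idₛ ,ₛ u) ⟩
  t [ s⁺ ∘ₛ (wkSub o idₛ ,ₛ u) ]          ≡⟨ cong (λ s' → t [ s' ,ₛ u ]) (wkSub-drop-∘ₛ s _ u) ⟩
  t [ s ∘ₛ wkSub o idₛ ,ₛ u ]             ≡⟨ cong (λ s' → t [ s' ,ₛ u ]) (wkSub-∘ₛ o s idₛ) ⟨
  t [ wkSub o (s ∘ₛ idₛ) ,ₛ u ]           ≡⟨ cong (λ s' → t [ wkSub o s' ,ₛ u ]) (∘ₛ-identityʳ s) ⟩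
  t [ wkSub o s ,ₛ u ]                    ∎))
  where
  open ≡-Reasoning
  s⁺ : (Γ , A) ⊢sub (Δ , A)
  s⁺ = wkSub (drop idOPE) s ,ₛ var zero

wk-factor-unbox : ∀ {Δ Γ A} (e : Δ ◁ Γ) (t : Δ ⊢ (□ A)) → wk (factor e) (unbox t nil) ≡ unbox t e
wk-factor-unbox e t rewrite factorWk-factor e = cong (λ t' → unbox t' e) (wk-id t)

-- Presheaves on order-preserving embeddings

record Psh : Set₁ where
  field
    Ob       : Ctx → Set
    _~_      : ∀ {Γ} → Ob Γ → Ob Γ → Set
    ~-refl   : ∀ {Γ} {x : Ob Γ} → x ~ x
    ~-sym    : ∀ {Γ} {x y : Ob Γ} → x ~ y → y ~ x
    ~-trans  : ∀ {Γ} {x y z : Ob Γ} → x ~ y → y ~ z → x ~ z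
    mon      : ∀ {Γ Γ'} → Γ ≤ Γ' → Ob Γ → Ob Γ'
    mon-resp : ∀ {Γ Γ'} (o : Γ ≤ Γ') {x y : Ob Γ} → x ~ y → mon o x ~ mon o y
    mon-id   : ∀ {Γ} (x : Ob Γ) → mon idOPE x ~ x
    mon-⊚    : ∀ {Γ Γ' Γ''} (o : Γ ≤ Γ') (o' : Γ' ≤ Γ'') (x : Ob Γ) →
               mon (o ⊚ o') x ~ mon o' (mon o x)

  ≡⇒~ : ∀ {Γ} {x y : Ob Γ} → x ≡ y → x ~ y
  ≡⇒~ refl = ~-refl
open Psh

record Hom (X Y : Psh) : Set where
  field
    fun  : ∀ {Γ} → Ob X Γ → Ob Y Γ
    resp : ∀ {Γ} {x y : Ob X Γ} → _~_ X x y → _~_ Y (fun x) (fun y)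
    nat  : ∀ {Γ Γ'} (o : Γ ≤ Γ') (x : Ob X Γ) → _~_ Y (fun (mon X o x)) (mon Y o (fun x))
open Hom

_≐_ : ∀ {X Y} → Hom X Y → Hom X Y → Set
_≐_ {X} {Y} f g = ∀ {Γ} (x : Ob X Γ) → _~_ Y (fun f x) (fun g x)

idH : ∀ {X} → Hom X X
idH {X} = record { fun = λ x → x ; resp = λ p → p ; nat = λ o x → ~-refl X }

_∘H_ : ∀ {X Y Z} → Hom Y Z → Hom X Y → Hom X Z
_∘H_ {Z = Z} g f = record
  { fun = λ x → fun g (fun f x)
  ; resp = λ p → resp g (resp f p)
  ; nat = λ o x → ~-trans Z (resp g (nat f o x)) (nat g o (fun f x))
  }

Psh-category : Category (lsuc 0ℓ) 0ℓ 0ℓ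
Psh-category = record
  { Obj = Psh
  ; _⇒ₕ_ = Hom
  ; _≈ₕ_ = _≐_
  ; id = idH
  ; _∘_ = _∘H_
  ; equiv = λ {X} {Y} → record
      { refl = λ x → ~-refl Y
      ; sym = λ p x → ~-sym Y (p x)
      ; trans = λ p q x → ~-trans Y (p x) (q x)
      }
  ; ∘-resp-≈ = λ {Z = Z} {f} {g' = g'} p q x → ~-trans Z (resp f (q x)) (p (fun g' x))
  ; assoc = λ {Z = Z} x → ~-refl Z
  ; identityˡ = λ {Y = Y} x → ~-refl Y
  ; identityʳ = λ {Y = Y} x → ~-refl Y
  }

⊤P : Psh
⊤P = record
  { Ob = λ _ → ⊤ ; _~_ = λ _ _ → ⊤ ; ~-refl = tt ; ~-sym = λ _ → tt ; ~-trans = λ _ _ → tt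
  ; mon = λ _ _ → tt ; mon-resp = λ _ _ → tt ; mon-id = λ _ → tt ; mon-⊚ = λ _ _ _ → tt
  }

_×P_ : Psh → Psh → Psh
X ×P Y = record
  { Ob = λ Γ → Ob X Γ × Ob Y Γ
  ; _~_ = λ p q → _~_ X (proj₁ p) (proj₁ q) × _~_ Y (proj₂ p) (proj₂ q)
  ; ~-refl = ~-refl X & ~-refl Y
  ; ~-sym = λ p → ~-sym X (proj₁ p) & ~-sym Y (proj₂ p)
  ; ~-trans = λ p q → ~-trans X (proj₁ p) (proj₁ q) & ~-trans Y (proj₂ p) (proj₂ q)
  ; mon = λ o p → mon X o (proj₁ p) & mon Y o (proj₂ p)
  ; mon-resp = λ o p → mon-resp X o (proj₁ p) & mon-resp Y o (proj₂ p)
  ; mon-id = λ p → mon-id X (proj₁ p) & mon-id Y (proj₂ p)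
  ; mon-⊚ = λ o o' p → mon-⊚ X o o' (proj₁ p) & mon-⊚ Y o o' (proj₂ p)
  }

record KripkeFun (X Y : Psh) (Γ : Ctx) : Set where
  field
    ap      : ∀ {Γ'} → Γ ≤ Γ' → Ob X Γ' → Ob Y Γ'
    ap-resp : ∀ {Γ'} (o : Γ ≤ Γ') {x y : Ob X Γ'} → _~_ X x y → _~_ Y (ap o x) (ap o y)
    ap-nat  : ∀ {Γ' Γ''} (o : Γ ≤ Γ') (o' : Γ' ≤ Γ'') (x : Ob X Γ') →
              _~_ Y (ap (o ⊚ o') (mon X o' x)) (mon Y o' (ap o x))
open KripkeFun

_⇨P_ : Psh → Psh → Psh
X ⇨P Y = record
  { Ob = KripkeFun X Y
  ; _~_ = λ {Γ} φ ψ → ∀ {Γ'} (o : Γ ≤ Γ') (x : Ob X Γ') → _~_ Y (ap φ o x) (ap ψ o x)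
  ; ~-refl = λ o x → ~-refl Y
  ; ~-sym = λ p o x → ~-sym Y (p o x)
  ; ~-trans = λ p q o x → ~-trans Y (p o x) (q o x)
  ; mon = λ o φ → record
      { ap = λ o' → ap φ (o ⊚ o')
      ; ap-resp = λ o' → ap-resp φ (o ⊚ o')
      ; ap-nat = λ o' o'' x →
          ~-trans Y (≡⇒~ Y (cong (λ o* → ap φ o* (mon X o'' x)) (sym (⊚-assoc o o' o''))))
                    (ap-nat φ (o ⊚ o') o'' x)
      }
  ; mon-resp = λ o p o' x → p (o ⊚ o') x
  ; mon-id = λ φ o x → ≡⇒~ Y (cong (λ o* → ap φ o* x) (⊚-identityˡ o))
  ; mon-⊚ = λ o o' φ o'' x → ≡⇒~ Y (cong (λ o* → ap φ o* x) (⊚-assoc o o' o''))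
  }

evalH : ∀ {X Y} → Hom ((X ⇨P Y) ×P X) Y
evalH {X} {Y} = record
  { fun = λ p → ap (proj₁ p) idOPE (proj₂ p)
  ; resp = λ {x = p} {q} r → ~-trans Y (proj₁ r idOPE (proj₂ p)) (ap-resp (proj₁ q) idOPE (proj₂ r))
  ; nat = λ o p →
      ~-trans Y (≡⇒~ Y (cong (λ o* → ap (proj₁ p) o* (mon X o (proj₂ p)))
                             (trans (⊚-identityʳ o) (sym (⊚-identityˡ o)))))
                (ap-nat (proj₁ p) idOPE o (proj₂ p))
  }

curryH : ∀ {Z X Y} → Hom (Z ×P X) Y → Hom Z (X ⇨P Y)
curryH {Z} {X} {Y} f = record
  { fun = λ z → record
      { ap = λ o x → fun f (mon Z o z & x)
      ; ap-resp = λ o q → resp f (~-refl Z & q)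
      ; ap-nat = λ o o' x → ~-trans Y (resp f (mon-⊚ Z o o' z & ~-refl X)) (nat f o' (mon Z o z & x))
      }
  ; resp = λ p o x → resp f (mon-resp Z o p & ~-refl X)
  ; nat = λ o z o' x → resp f (~-sym Z (mon-⊚ Z o o' z) & ~-refl X)
  }

Psh-ccc : CCC (lsuc 0ℓ) 0ℓ 0ℓ
Psh-ccc = record
  { category = Psh-category
  ; ⊤ = ⊤P
  ; ! = record { fun = λ _ → tt ; resp = λ _ → tt ; nat = λ _ _ → tt }
  ; !-unique = λ f x → tt
  ; _×_ = _×P_
  ; π₁ = λ {X} → record { fun = proj₁ ; resp = proj₁ ; nat = λ o p → ~-refl X }
  ; π₂ = λ {Y = Y} → record { fun = proj₂ ; resp = proj₂ ; nat = λ o p → ~-refl Y }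
  ; ⟨_,_⟩ = λ f g → record
      { fun = λ z → fun f z & fun g z
      ; resp = λ p → resp f p & resp g p
      ; nat = λ o z → nat f o z & nat g o z
      }
  ; project₁ = λ {X = X} x → ~-refl X
  ; project₂ = λ {Y = Y} x → ~-refl Y
  ; ⟨⟩-unique = λ {X = X} {Y} p q x → ~-sym X (p x) & ~-sym Y (q x)
  ; _⇨_ = _⇨P_
  ; eval = evalH
  ; curry = curryH
  ; eval-β = λ {Z} {X} {f = f} p → resp f (mon-id Z (proj₁ p) & ~-refl X)
  ; curry-unique = λ {Z} {Y = Y} {g = g} h z o x →
      ~-trans Y (~-sym Y (h (mon Z o z & x)))
                (~-trans Y (nat g o z idOPE x) (≡⇒~ Y (cong (λ o* → ap (fun g z) o* x) (⊚-identityʳ o))))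
  }

record LEl (X : Psh) (Γ : Ctx) : Set where
  constructor lel
  field
    {lctx} : Ctx
    lacc   : lctx ◁ Γ
    lval   : Ob X lctx
open LEl

data LEq (X : Psh) {Γ : Ctx} : LEl X Γ → LEl X Γ → Set where
  leq : ∀ {Δ} {e : Δ ◁ Γ} {x y : Ob X Δ} → _~_ X x y → LEq X (lel e x) (lel e y)

monL : ∀ (X : Psh) {Γ Γ'} → Γ ≤ Γ' → LEl X Γ → LEl X Γ'
monL X o (lel e x) = lel (acc (factorWk e o)) (mon X (ope (factorWk e o)) x)

LP : Psh → Psh
LP X = record
  { Ob = LEl X
  ; _~_ = LEq X
  ; ~-refl = leq (~-refl X)
  ; ~-sym = λ { (leq p) → leq (~-sym X p) }
  ; ~-trans = λ { (leq p) (leq q) → leq (~-trans X p q) }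
  ; mon = monL X
  ; mon-resp = λ { o (leq p) → leq (mon-resp X _ p) }
  ; mon-id = monL-id
  ; mon-⊚ = monL-⊚
  }
  where
  monL-id : ∀ {Γ} (r : LEl X Γ) → LEq X (monL X idOPE r) r
  monL-id (lel e x) rewrite factorWk-id e = leq (mon-id X x)

  monL-⊚ : ∀ {Γ Γ' Γ''} (o : Γ ≤ Γ') (o' : Γ' ≤ Γ'') (r : LEl X Γ) →
           LEq X (monL X (o ⊚ o') r) (monL X o' (monL X o r))
  monL-⊚ o o' (lel e x) rewrite factorWk-⊚ e o o' = leq (mon-⊚ X _ _ x)

LF : Endofunctor Psh-category
LF = record
  { F₀ = LP
  ; F₁ = λ f → record
      { fun = λ r → lel (lacc r) (fun f (lval r))
      ; resp = λ { (leq p) → leq (resp f p) }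
      ; nat = λ o r → leq (nat f _ (lval r))
      }
  ; identity = λ {X} r → leq (~-refl X)
  ; homomorphism = λ {Z = Z} r → leq (~-refl Z)
  ; F-resp-≈ = λ p r → leq (p (lval r))
  }

RP : Psh → Psh
RP X = record
  { Ob = λ Γ → Ob X (Γ ,■)
  ; _~_ = _~_ X
  ; ~-refl = ~-refl X
  ; ~-sym = ~-sym X
  ; ~-trans = ~-trans X
  ; mon = λ o → mon X (keep■ o)
  ; mon-resp = λ o → mon-resp X (keep■ o)
  ; mon-id = mon-id X
  ; mon-⊚ = λ o o' → mon-⊚ X (keep■ o) (keep■ o')
  }

RF : Endofunctor Psh-category
RF = record
  { F₀ = RP
  ; F₁ = λ f → record { fun = fun f ; resp = resp f ; nat = λ o → nat f (keep■ o) }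
  ; identity = λ {X} x → ~-refl X
  ; homomorphism = λ {Z = Z} x → ~-refl Z
  ; F-resp-≈ = λ p x → p x
  }

εH : ∀ X → Hom (LP (RP X)) X
εH X = record
  { fun = λ { (lel e x) → mon X (factor e) x }
  ; resp = λ { (leq p) → mon-resp X _ p }
  ; nat = λ { o (lel e x) →
      ~-trans X (~-sym X (mon-⊚ X _ _ x))
        (~-trans X (≡⇒~ X (cong (λ o* → mon X o* x) (sym (factor-natural e o))))
                   (mon-⊚ X _ _ x)) }
  }

L⊣R : Adjunction LF RF
L⊣R = record
  { η = λ X → record { fun = lel nil ; resp = leq ; nat = λ o x → leq (~-refl X) }
  ; ε = εH
  ; η-natural = λ {Y = Y} f x → leq (~-refl Y)
  ; ε-natural = λ {Y = Y} f r → ~-sym Y (nat f _ (lval r))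
  ; zig = λ {X} → zig
  ; zag = λ {X} y → mon-id X y
  }
  where
  zig : ∀ {X Γ} (r : LEl X Γ) → LEq X (monL X (factor (lacc r)) (lel nil (lval r))) r
  zig {X} (lel e x) rewrite factorWk-factor e = leq (mon-id X x)

ιP : Psh
ιP = record
  { Ob = λ Γ → Γ ⊢ ι
  ; _~_ = _≡_
  ; ~-refl = refl
  ; ~-sym = sym
  ; ~-trans = trans
  ; mon = wk
  ; mon-resp = λ o → cong (wk o)
  ; mon-id = wk-id
  ; mon-⊚ = λ o o' t → sym (wk-⊚ o o' t)
  }

-- Normalisation by evaluation

open Interp Psh-ccc LF RF L⊣R ιP

mutual
  reify : ∀ A {Γ} → Ob ⟦ A ⟧ty Γ → Γ ⊢ A
  reify ι t = t
  reify (A ⇒ B) φ = lam (reify B (ap φ (drop idOPE) (reflect A (var zero))))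
  reify (□ A) v = box (reify A v)

  reflect : ∀ A {Γ} → Γ ⊢ A → Ob ⟦ A ⟧ty Γ
  reflect ι t = t
  reflect (A ⇒ B) t = record
    { ap = λ o x → reflect B (app (wk o t) (reify A x))
    ; ap-resp = λ o p → ≡⇒~ ⟦ B ⟧ty (cong (λ u → reflect B (app (wk o t) u)) (reify-resp A p))
    ; ap-nat = λ o o' x → ~-trans ⟦ B ⟧ty
        (≡⇒~ ⟦ B ⟧ty (cong (reflect B) (cong₂ app (sym (wk-⊚ o o' t)) (reify-natural A o' x))))
        (~-sym ⟦ B ⟧ty (reflect-natural B o' _))
    }
  reflect (□ A) t = reflect A (unbox t nil)

  reify-resp : ∀ A {Γ} {x y : Ob ⟦ A ⟧ty Γ} → _~_ ⟦ A ⟧ty x y → reify A x ≡ reify A y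
  reify-resp ι p = p
  reify-resp (A ⇒ B) p = cong lam (reify-resp B (p (drop idOPE) (reflect A (var zero))))
  reify-resp (□ A) p = cong box (reify-resp A p)

  reify-natural : ∀ A {Γ Γ'} (o : Γ ≤ Γ') (x : Ob ⟦ A ⟧ty Γ) →
                  reify A (mon ⟦ A ⟧ty o x) ≡ wk o (reify A x)
  reify-natural ι o x = refl
  reify-natural (A ⇒ B) o φ = cong lam (begin
    reify B (ap φ (o ⊚ drop idOPE) x₀)
      ≡⟨ cong (λ o* → reify B (ap φ o* x₀)) (drop-id-natural o) ⟩
    reify B (ap φ (drop idOPE ⊚ keep o) x₀)
      ≡⟨ reify-resp B (ap-resp φ _ (~-sym ⟦ A ⟧ty (reflect-natural A (keep o) (var zero)))) ⟩
    reify B (ap φ (drop idOPE ⊚ keep o) (mon ⟦ A ⟧ty (keep o) x₀))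
      ≡⟨ reify-resp B (ap-nat φ (drop idOPE) (keep o) x₀) ⟩
    reify B (mon ⟦ B ⟧ty (keep o) (ap φ (drop idOPE) x₀))
      ≡⟨ reify-natural B (keep o) _ ⟩
    wk (keep o) (reify B (ap φ (drop idOPE) x₀)) ∎)
    where
    open ≡-Reasoning
    x₀ : ∀ {Δ} → Ob ⟦ A ⟧ty (Δ , A)
    x₀ = reflect A (var zero)
  reify-natural (□ A) o v = cong box (reify-natural A (keep■ o) v)

  reflect-natural : ∀ A {Γ Γ'} (o : Γ ≤ Γ') (t : Γ ⊢ A) →
                    _~_ ⟦ A ⟧ty (mon ⟦ A ⟧ty o (reflect A t)) (reflect A (wk o t))
  reflect-natural ι o t = refl
  reflect-natural (A ⇒ B) o t o' x =
    ≡⇒~ ⟦ B ⟧ty (cong (λ u → reflect B (app u (reify A x))) (sym (wk-⊚ o o' t)))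
  reflect-natural (□ A) o t = reflect-natural A (keep■ o) (unbox t nil)

Related : ∀ A {Γ} → Ob ⟦ A ⟧ty Γ → Γ ⊢ A → Set
Related ι v t = v ≈ t
Related (A ⇒ B) {Γ} φ t =
  ∀ {Γ'} (o : Γ ≤ Γ') {x u} → Related A x u → Related B (ap φ o x) (app (wk o t) u)
Related (□ A) v t = Related A v (unbox t nil)

Related-≈ : ∀ A {Γ} {v : Ob ⟦ A ⟧ty Γ} {t t'} → Related A v t → t ≈ t' → Related A v t'
Related-≈ ι p q = ≈-trans p q
Related-≈ (A ⇒ B) h q o r = Related-≈ B (h o r) (cong-app (wk-resp-≈ o q) ≈-refl)
Related-≈ (□ A) h q = Related-≈ A h (cong-unbox q)

Related-mon : ∀ A {Γ Γ'} (o : Γ ≤ Γ') {v : Ob ⟦ A ⟧ty Γ} {t} →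
              Related A v t → Related A (mon ⟦ A ⟧ty o v) (wk o t)
Related-mon ι o p = wk-resp-≈ o p
Related-mon (A ⇒ B) o {t = t} h o' r =
  Related-≈ B (h (o ⊚ o') r) (cong-app (≡⇒≈ (sym (wk-⊚ o o' t))) ≈-refl)
Related-mon (□ A) o h = Related-mon A (keep■ o) h

mutual
  reflect-related : ∀ A {Γ} (t : Γ ⊢ A) → Related A (reflect A t) t
  reflect-related ι t = ≈-refl
  reflect-related (A ⇒ B) t o r = Related-≈ B (reflect-related B _) (cong-app ≈-refl (reify-related A r))
  reflect-related (□ A) t = reflect-related A (unbox t nil)

  reify-related : ∀ A {Γ} {v : Ob ⟦ A ⟧ty Γ} {t} → Related A v t → reify A v ≈ t
  reify-related ι p = p
  reify-related (A ⇒ B) {t = t} h =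
    ≈-trans (cong-lam (reify-related B (h (drop idOPE) (reflect-related A (var zero))))) (≈-sym (⇒-η t))
  reify-related (□ A) {t = t} h = ≈-trans (cong-box (reify-related A h)) (≈-sym (□-η t))

data RelatedL {Δ : Ctx} (P : ∀ {Θ} → Ob ⟦ Δ ⟧ctx Θ → Θ ⊢sub Δ → Set) {Γ : Ctx} :
              LEl ⟦ Δ ⟧ctx Γ → Γ ⊢sub (Δ ,■) → Set where
  related-lock : ∀ {Θ} {e : Θ ◁ Γ} {x s} → P x s → RelatedL P (lel e x) (lock s e)

RelatedEnv : ∀ Δ {Γ} → Ob ⟦ Δ ⟧ctx Γ → Γ ⊢sub Δ → Set
RelatedEnv · _ _ = ⊤
RelatedEnv (Δ , A) ρ (s ,ₛ t) = RelatedEnv Δ (proj₁ ρ) s × Related A (proj₂ ρ) t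
RelatedEnv (Δ ,■) ρ s = RelatedL (RelatedEnv Δ) ρ s

RelatedEnv-mon : ∀ Δ {Γ Γ'} (o : Γ ≤ Γ') {ρ : Ob ⟦ Δ ⟧ctx Γ} {s} →
                 RelatedEnv Δ ρ s → RelatedEnv Δ (mon ⟦ Δ ⟧ctx o ρ) (wkSub o s)
RelatedEnv-mon · o p = tt
RelatedEnv-mon (Δ , A) o {s = s ,ₛ t} (p & q) = RelatedEnv-mon Δ o p & Related-mon A o q
RelatedEnv-mon (Δ ,■) o (related-lock {e = e} p) = related-lock (RelatedEnv-mon Δ (ope (factorWk e o)) p)

substVar-related : ∀ {Δ A Γ} (v : Δ ⊢var A) {ρ : Ob ⟦ Δ ⟧ctx Γ} {s} →
                   RelatedEnv Δ ρ s → Related A (fun ⟦ v ⟧var ρ) (substVar v s)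
substVar-related zero {s = s ,ₛ t} (p & q) = q
substVar-related (succ v) {s = s ,ₛ t} (p & q) = substVar-related v p

factorSub-related : ∀ {Γ Δ Θ} (e : Δ ◁ Γ) {ρ : Ob ⟦ Γ ⟧ctx Θ} {s : Θ ⊢sub Γ} →
                    let r = factorSub e s in
                    RelatedEnv Γ ρ s → RelatedL (RelatedEnv Δ) (fun ⟦ e ⟧acc ρ) (lock (sub r) (acc r))
factorSub-related nil {s = lock s e} r = r
factorSub-related (ext e) {s = s ,ₛ t} (r & _) = factorSub-related e r

subst-related : ∀ {Δ A Γ} (t : Δ ⊢ A) {ρ : Ob ⟦ Δ ⟧ctx Γ} {s} →
                RelatedEnv Δ ρ s → Related A (fun ⟦ t ⟧tm ρ) (t [ s ])
subst-related (var v) r = substVar-related v r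
subst-related {Δ} {A ⇒ B} (lam t) {ρ} {s} r o {x} {u} q =
  Related-≈ B (subst-related t {mon ⟦ Δ ⟧ctx o ρ & x} {wkSub o s ,ₛ u} (RelatedEnv-mon Δ o r & q))
              (≈-sym (app-lam-wk t s o u))
subst-related {A = B} (app t u) r =
  Related-≈ B (subst-related t r idOPE (subst-related u r)) (cong-app (≡⇒≈ (wk-id _)) ≈-refl)
subst-related {A = □ A} (box t) {s = s} r =
  Related-≈ A (subst-related t {s = lock s nil} (related-lock r))
              (≈-sym (≈-trans (□-β _ nil) (≡⇒≈ (wk-id _))))
subst-related {A = A} (unbox t e) {ρ} {s} r
  with fun ⟦ e ⟧acc ρ | factorSub e s | factorSub-related e r
... | lel e' x | fs s' e' | related-lock p =
  Related-≈ A (Related-mon A (factor e') (subst-related t p)) (≡⇒≈ (wk-factor-unbox e' _))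

idEnv : ∀ Γ → Ob ⟦ Γ ⟧ctx Γ
idEnv · = tt
idEnv (Γ , A) = mon ⟦ Γ ⟧ctx (drop idOPE) (idEnv Γ) & reflect A (var zero)
idEnv (Γ ,■) = lel nil (idEnv Γ)

idEnv-related : ∀ Γ → RelatedEnv Γ (idEnv Γ) idₛ
idEnv-related · = tt
idEnv-related (Γ , A) = RelatedEnv-mon Γ (drop idOPE) (idEnv-related Γ) & reflect-related A (var zero)
idEnv-related (Γ ,■) = related-lock (idEnv-related Γ)

nf : ∀ {Γ A} → Γ ⊢ A → Γ ⊢ A
nf {Γ} {A} t = reify A (fun ⟦ t ⟧tm (idEnv Γ))

nf-sound : ∀ {Γ A} (t : Γ ⊢ A) → nf t ≈ t
nf-sound {Γ} {A} t = ≈-trans (reify-related A (subst-related t (idEnv-related Γ))) (≡⇒≈ (subst-id t))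

nf-cong : ∀ {Γ A} (t u : Γ ⊢ A) → ⟦ t ⟧tm ≐ ⟦ u ⟧tm → nf t ≡ nf u
nf-cong {Γ} {A} t u ⟦t⟧≐⟦u⟧ = reify-resp A (⟦t⟧≐⟦u⟧ (idEnv Γ))

theorem4p1 : ∀ {Γ A} (t u : Γ ⊢ A) →
    (∀ {o ℓ e} (𝒞 : CCC o ℓ e) (L R : Endofunctor (CCC.category 𝒞))
       (adj : Adjunction L R) (ιobj : CCC.Obj 𝒞) →
       CCC._≈ₕ_ 𝒞 (Interp.⟦_⟧tm 𝒞 L R adj ιobj t) (Interp.⟦_⟧tm 𝒞 L R adj ιobj u)) →
    t ≈ u
theorem4p1 {Γ} {A} t u ⟦t⟧≈⟦u⟧ = begin
  t     ≈⟨ nf-sound t ⟨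
  nf t  ≡⟨ nf-cong t u (⟦t⟧≈⟦u⟧ Psh-ccc LF RF L⊣R ιP) ⟩
  nf u  ≈⟨ nf-sound u ⟩
  u     ∎
  where open SetoidReasoning (≈-setoid Γ A)
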